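{- Let $\mathcal P$ be a set of formulas and let $\mathcal K$ be a stable set of formulas such that $\mathcal K\subseteq\mathcal P$ and $0\notin\mathcal K$. If $\Gamma,\Delta$ are finite multisets of formulas of $\mathcal K$, then $\Gamma\vdash_{\mathcal P}\Delta;$ (with empty stoup) if and only if $\Gamma\vdash_{\mathrm{LK}}\Delta$.
   Context: Formulas are given by the grammar $F ::= 0 \mid \perp \mid X \mid F\wedge F \mid F\vee F \mid F\rightarrow F$, where $X$ ranges over a set $\mathcal V$ of propositional variables and $0$, $\perp$ are two distinct constants. A set $\mathcal S$ of formulas is stable if for every $c\in\{\wedge,\vee,\rightarrow\}$, $A\,c\,B\in\mathcal S$ implies $A,B\in\mathcal S$. $\mathrm{LK}$ denotes Gentzen's classical propositional sequent calculus over formulas built from the variables $\mathcal V$ and the constant $\perp$ with $\wedge,\vee,\rightarrow$, where $\perp$ is the absurdity (with the axiom $\perp\vdash$); $\Gamma\vdash_{\mathrm{LK}}\Delta$ means the sequent is derivable in LK. Fix a set $\mathcal P$ of formulas. A $\mathcal P$-sequent is an expression $\Gamma\vdash\Delta;\Pi$ where $\Gamma,\Delta,\Pi$ are finite multisets of formulas, every formula of $\Delta$ (the body) belongs to $\mathcal P$, and $\Pi$ (the stoup) contains at most one formula. The system $\mathrm{ML}_{\mathcal P}$ derives $\mathcal P$-sequents with the following rules (below $C$ denotes a single formula, $\Pi$ a stoup with at most one formula, and all sequents must be $\mathcal P$-sequents): Axiom/cuts: $ax$: $A\vdash ;A$. $cut_1$: from $\Gamma\vdash\Delta;A$ and $\Gamma',A\vdash\Delta';\Pi$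 infer $\Gamma,\Gamma'\vdash\Delta,\Delta';\Pi$. $cut_2$: from $\Gamma\vdash\Delta,A;\Pi$ and $\Gamma',A\vdash\Delta';$ infer $\Gamma,\Gamma'\vdash\Delta,\Delta';\Pi$. Structure: $der$: from $\Gamma\vdash\Delta;A$ with $A\in\mathcal P$ infer $\Gamma\vdash\Delta,A;$. $c_l$: from $\Gamma,A,A\vdash\Delta;\Pi$ infer $\Gamma,A\vdash\Delta;\Pi$. $c_r$: from $\Gamma\vdash\Delta,A,A;\Pi$ infer $\Gamma\vdash\Delta,A;\Pi$. $w_l$: from $\Gamma\vdash\Delta;\Pi$ infer $\Gamma,A\vdash\Delta;\Pi$. $w_r$: from $\Gamma\vdash\Delta;\Pi$ with $A\in\mathcal P$ infer $\Gamma\vdash\Delta,A;\Pi$. Logic: $0$: $\Gamma,0\vdash\Delta;\Pi$ (any $\Delta\subseteq\mathcal P$). $\perp$: $\perp\vdash ;$. $\wedge^1_l$: from $\Gamma,A,B\vdash\Delta;C$ with $A\notin\mathcal P$ and $B\notin\mathcal P$ infer $\Gamma,A\wedge B\vdash\Delta;C$. $\wedge^2_l$: from $\Gamma,A,B\vdash\Delta;$ infer $\Gamma,A\wedge B\vdash\Delta;$. $\wedge^1_r$: from $\Gamma\vdash\Delta;A$ and $\Gamma'\vdash\Delta';B$ infer $\Gamma,\Gamma'\vdash\Delta,\Delta';A\wedge B$. $\wedge^2_r$: from $\Gamma\vdash\Delta,A;$ and $\Gamma'\vdash\Delta',B;$ infer the same conclusion. $\wedge^3_r$: from $\Gamma\vdash\Delta;A$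 and $\Gamma'\vdash\Delta',B;$ infer the same conclusion. $\wedge^4_r$: from $\Gamma\vdash\Delta,A;$ and $\Gamma'\vdash\Delta';B$ infer the same conclusion. $\vee^1_l$: from $\Gamma,A\vdash\Delta;C$ and $\Gamma,B\vdash\Delta;C$ with $A\notin\mathcal P$ and $B\notin\mathcal P$ infer $\Gamma,A\vee B\vdash\Delta;C$. $\vee^2_l$: from $\Gamma,A\vdash\Delta;$ and $\Gamma,B\vdash\Delta;$ infer $\Gamma,A\vee B\vdash\Delta;$. $\vee^1_r$: from $\Gamma\vdash\Delta;A$ infer $\Gamma\vdash\Delta;A\vee B$. $\vee^2_r$: from $\Gamma\vdash\Delta;B$ infer $\Gamma\vdash\Delta;A\vee B$. $\vee^3_r$: from $\Gamma\vdash\Delta,A;$ infer $\Gamma\vdash\Delta;A\vee B$. $\vee^4_r$: from $\Gamma\vdash\Delta,B;$ infer $\Gamma\vdash\Delta;A\vee B$. $\rightarrow^1_l$: from $\Gamma,B\vdash\Delta;C$ and $\Gamma'\vdash\Delta';A$ with $B\notin\mathcal P$ infer $\Gamma,\Gamma',A\rightarrow B\vdash\Delta,\Delta';C$. $\rightarrow^2_l$: from $\Gamma,B\vdash\Delta;$ and $\Gamma'\vdash\Delta';A$ infer $\Gamma,\Gamma',A\rightarrow B\vdash\Delta,\Delta';$. $\rightarrow^3_l$: from $\Gamma,B\vdash\Delta;$ and $\Gamma'\vdash\Delta',A;\Pi$ infer $\Gamma,\Gamma',A\rightarrow B\vdash\Delta,\Delta';\Pi$. $\rightarrow^1_r$: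 from $\Gamma,A\vdash\Delta;B$ infer $\Gamma\vdash\Delta;A\rightarrow B$. $\rightarrow^2_r$: from $\Gamma,A\vdash\Delta,B;$ infer $\Gamma\vdash\Delta;A\rightarrow B$. One writes $\Gamma\vdash_{\mathcal P}\Delta;\Pi$ when the $\mathcal P$-sequent $\Gamma\vdash\Delta;\Pi$ is derivable in $\mathrm{ML}_{\mathcal P}$. -}

module Defs where

open import Data.List using (List; []; _∷_; _++_; [_]; map)
open import Data.List.Relation.Unary.All using (All)
open import Data.List.Relation.Binary.Permutation.Propositional using (_↭_)
open import Data.Maybe using (Maybe; just; nothing)
open import Data.Product using (_×_)
open import Relation.Nullary using (¬_)

infixr 6 _⋀_
infixr 5 _⋁_
infixr 4 _⇒_

data Fm (V : Set) : Set where
  𝟘    : Fm V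
  ⊥'   : Fm V
  var  : V → Fm V
  _⋀_  : Fm V → Fm V → Fm V
  _⋁_  : Fm V → Fm V → Fm V
  _⇒_  : Fm V → Fm V → Fm V

FmSet : Set → Set₁
FmSet V = Fm V → Set

Stable : {V : Set} → FmSet V → Set
Stable {V} S =
  (∀ (A B : Fm V) → S (A ⋀ B) → S A × S B) ×
  (∀ (A B : Fm V) → S (A ⋁ B) → S A × S B) ×
  (∀ (A B : Fm V) → S (A ⇒ B) → S A × S B)

-- Multisets are lists; the exchange rules exˡ / exʳ
-- (closure under permutation) make derivability a property of multisets.
-- The stoup is  Maybe (Fm V)  (at most one formula).
-- Every derivable sequent is a P-sequent: the only rules that put new
-- formulas into the body (der, wʳ, 𝟘-rule) carry the membership condition.
data ML {V : Set} (P : FmSet V) : List (Fm V) → List (Fm V) → Maybe (Fm V) → Set where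
  ax   : ∀ {A} → ML P [ A ] [] (just A)
  cut₁ : ∀ {Γ Γ' Δ Δ' A Π} → ML P Γ Δ (just A) → ML P (A ∷ Γ') Δ' Π
       → ML P (Γ ++ Γ') (Δ ++ Δ') Π
  cut₂ : ∀ {Γ Γ' Δ Δ' A Π} → ML P Γ (A ∷ Δ) Π → ML P (A ∷ Γ') Δ' nothing
       → ML P (Γ ++ Γ') (Δ ++ Δ') Π
  der  : ∀ {Γ Δ A} → P A → ML P Γ Δ (just A) → ML P Γ (A ∷ Δ) nothing
  cˡ   : ∀ {Γ Δ A Π} → ML P (A ∷ A ∷ Γ) Δ Π → ML P (A ∷ Γ) Δ Π
  cʳ   : ∀ {Γ Δ A Π} → ML P Γ (A ∷ A ∷ Δ) Π → ML P Γ (A ∷ Δ) Π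
  wˡ   : ∀ {Γ Δ A Π} → ML P Γ Δ Π → ML P (A ∷ Γ) Δ Π
  wʳ   : ∀ {Γ Δ A Π} → P A → ML P Γ Δ Π → ML P Γ (A ∷ Δ) Π
  exˡ  : ∀ {Γ Γ' Δ Π} → Γ ↭ Γ' → ML P Γ Δ Π → ML P Γ' Δ Π
  exʳ  : ∀ {Γ Δ Δ' Π} → Δ ↭ Δ' → ML P Γ Δ Π → ML P Γ Δ' Π
  zero : ∀ {Γ Δ Π} → All P Δ → ML P (𝟘 ∷ Γ) Δ Π
  bot  : ML P [ ⊥' ] [] nothing
  ∧ˡ₁  : ∀ {Γ Δ A B C} → ¬ P A → ¬ P B → ML P (A ∷ B ∷ Γ) Δ (just C)
       → ML P ((A ⋀ B) ∷ Γ) Δ (just C)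
  ∧ˡ₂  : ∀ {Γ Δ A B} → ML P (A ∷ B ∷ Γ) Δ nothing → ML P ((A ⋀ B) ∷ Γ) Δ nothing
  ∧ʳ₁  : ∀ {Γ Γ' Δ Δ' A B} → ML P Γ Δ (just A) → ML P Γ' Δ' (just B)
       → ML P (Γ ++ Γ') (Δ ++ Δ') (just (A ⋀ B))
  ∧ʳ₂  : ∀ {Γ Γ' Δ Δ' A B} → ML P Γ (A ∷ Δ) nothing → ML P Γ' (B ∷ Δ') nothing
       → ML P (Γ ++ Γ') (Δ ++ Δ') (just (A ⋀ B))
  ∧ʳ₃  : ∀ {Γ Γ' Δ Δ' A B} → ML P Γ Δ (just A) → ML P Γ' (B ∷ Δ') nothing
       → ML P (Γ ++ Γ') (Δ ++ Δ') (just (A ⋀ B))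
  ∧ʳ₄  : ∀ {Γ Γ' Δ Δ' A B} → ML P Γ (A ∷ Δ) nothing → ML P Γ' Δ' (just B)
       → ML P (Γ ++ Γ') (Δ ++ Δ') (just (A ⋀ B))
  ∨ˡ₁  : ∀ {Γ Δ A B C} → ¬ P A → ¬ P B → ML P (A ∷ Γ) Δ (just C) → ML P (B ∷ Γ) Δ (just C)
       → ML P ((A ⋁ B) ∷ Γ) Δ (just C)
  ∨ˡ₂  : ∀ {Γ Δ A B} → ML P (A ∷ Γ) Δ nothing → ML P (B ∷ Γ) Δ nothing
       → ML P ((A ⋁ B) ∷ Γ) Δ nothing
  ∨ʳ₁  : ∀ {Γ Δ A B} → ML P Γ Δ (just A) → ML P Γ Δ (just (A ⋁ B))
  ∨ʳ₂  : ∀ {Γ Δ A B} → ML P Γ Δ (just B) → ML P Γ Δ (just (A ⋁ B))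
  ∨ʳ₃  : ∀ {Γ Δ A B} → ML P Γ (A ∷ Δ) nothing → ML P Γ Δ (just (A ⋁ B))
  ∨ʳ₄  : ∀ {Γ Δ A B} → ML P Γ (B ∷ Δ) nothing → ML P Γ Δ (just (A ⋁ B))
  →ˡ₁  : ∀ {Γ Γ' Δ Δ' A B C} → ¬ P B → ML P (B ∷ Γ) Δ (just C) → ML P Γ' Δ' (just A)
       → ML P ((A ⇒ B) ∷ Γ ++ Γ') (Δ ++ Δ') (just C)
  →ˡ₂  : ∀ {Γ Γ' Δ Δ' A B} → ML P (B ∷ Γ) Δ nothing → ML P Γ' Δ' (just A)
       → ML P ((A ⇒ B) ∷ Γ ++ Γ') (Δ ++ Δ') nothing
  →ˡ₃  : ∀ {Γ Γ' Δ Δ' A B Π} → ML P (B ∷ Γ) Δ nothing → ML P Γ' (A ∷ Δ') Π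
       → ML P ((A ⇒ B) ∷ Γ ++ Γ') (Δ ++ Δ') Π
  →ʳ₁  : ∀ {Γ Δ A B} → ML P (A ∷ Γ) Δ (just B) → ML P Γ Δ (just (A ⇒ B))
  →ʳ₂  : ∀ {Γ Δ A B} → ML P (A ∷ Γ) (B ∷ Δ) nothing → ML P Γ Δ (just (A ⇒ B))

data LFm (V : Set) : Set where
  ⊥ᴸ   : LFm V
  varᴸ : V → LFm V
  _∧ᴸ_ : LFm V → LFm V → LFm V
  _∨ᴸ_ : LFm V → LFm V → LFm V
  _→ᴸ_ : LFm V → LFm V → LFm V

ι : {V : Set} → LFm V → Fm V
ι ⊥ᴸ       = ⊥'
ι (varᴸ x) = var x
ι (A ∧ᴸ B) = ι A ⋀ ι B
ι (A ∨ᴸ B) = ι A ⋁ ι B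
ι (A →ᴸ B) = ι A ⇒ ι B

data LK {V : Set} : List (LFm V) → List (LFm V) → Set where
  ax   : ∀ {A} → LK [ A ] [ A ]
  bot  : LK [ ⊥ᴸ ] []
  cut  : ∀ {Γ Γ' Δ Δ' A} → LK Γ (A ∷ Δ) → LK (A ∷ Γ') Δ' → LK (Γ ++ Γ') (Δ ++ Δ')
  wˡ   : ∀ {Γ Δ A} → LK Γ Δ → LK (A ∷ Γ) Δ
  wʳ   : ∀ {Γ Δ A} → LK Γ Δ → LK Γ (A ∷ Δ)
  cˡ   : ∀ {Γ Δ A} → LK (A ∷ A ∷ Γ) Δ → LK (A ∷ Γ) Δ
  cʳ   : ∀ {Γ Δ A} → LK Γ (A ∷ A ∷ Δ) → LK Γ (A ∷ Δ)
  exˡ  : ∀ {Γ Γ' Δ} → Γ ↭ Γ' → LK Γ Δ → LK Γ' Δ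
  exʳ  : ∀ {Γ Δ Δ'} → Δ ↭ Δ' → LK Γ Δ → LK Γ Δ'
  ∧ˡ₁  : ∀ {Γ Δ A B} → LK (A ∷ Γ) Δ → LK ((A ∧ᴸ B) ∷ Γ) Δ
  ∧ˡ₂  : ∀ {Γ Δ A B} → LK (B ∷ Γ) Δ → LK ((A ∧ᴸ B) ∷ Γ) Δ
  ∧ʳ   : ∀ {Γ Δ A B} → LK Γ (A ∷ Δ) → LK Γ (B ∷ Δ) → LK Γ ((A ∧ᴸ B) ∷ Δ)
  ∨ˡ   : ∀ {Γ Δ A B} → LK (A ∷ Γ) Δ → LK (B ∷ Γ) Δ → LK ((A ∨ᴸ B) ∷ Γ) Δ
  ∨ʳ₁  : ∀ {Γ Δ A B} → LK Γ (A ∷ Δ) → LK Γ ((A ∨ᴸ B) ∷ Δ)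
  ∨ʳ₂  : ∀ {Γ Δ A B} → LK Γ (B ∷ Δ) → LK Γ ((A ∨ᴸ B) ∷ Δ)
  →ˡ   : ∀ {Γ Γ' Δ Δ' A B} → LK Γ (A ∷ Δ) → LK (B ∷ Γ') Δ'
       → LK ((A →ᴸ B) ∷ Γ ++ Γ') (Δ ++ Δ')
  →ʳ   : ∀ {Γ Δ A B} → LK (A ∷ Γ) (B ∷ Δ) → LK Γ ((A →ᴸ B) ∷ Δ)

-- ML ⇒ LK: reading the stoup as one more succedent formula and 0 as ⊥, every rule of ML_P
-- is an admissible rule of LK.
--
-- LK ⇒ ML: LK (cut included) is sound for Kripke models with fallible worlds in which
-- disjunction and atoms are read double-negatively.  In the universal model the worlds are
-- sequents Γ ⊢ Δ, and a world is fallible when all its extensions by formulas of K are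
-- ML-derivable with empty stoup.  By induction on formulas, a formula is forced where it is
-- a hypothesis and, where it is forced, may be added to the conclusions; stability of K keeps
-- subformulas in K and K ⊆ P lets principal formulas enter the body.  Soundness at the world
-- Γ ⊢ Δ then turns an LK-derivation into an ML-derivation, with no cut elimination needed
-- although LK cut formulas need not lie in K.

module Submission where

open import Defs
open import Data.List using (List; []; _∷_; _++_; [_]; map; fromMaybe)
open import Data.List.Properties using (map-++; map-∘; map-id-local)
open import Data.List.Membership.Propositional using (_∈_)
open import Data.List.Membership.Propositional.Properties using (∈-∃++; ∈-map⁺; ∈-++⁻)
open import Data.List.Relation.Binary.Subset.Propositional using (_⊆_)
open import Data.List.Relation.Binary.Subset.Propositional.Properties
  using (⊆-refl; ⊆-trans; ⊆-reflexive-↭; xs⊆x∷xs; ∷⁺ʳ; ∈-∷⁺ʳ; xs⊆xs++ys; xs⊆ys++xs; ++⁺ʳ)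
  renaming (map⁺ to ⊆-map⁺)
open import Data.List.Relation.Binary.Permutation.Propositional using (_↭_; prep; swap; ↭-refl; ↭-sym)
open import Data.List.Relation.Binary.Permutation.Propositional.Properties
  using (All-resp-↭; shift; shifts; ++-comm)
  renaming (map⁺ to ↭-map⁺; ++⁺ˡ to ↭-++⁺ˡ; ++-assoc to ↭-++-assoc)
open import Data.List.Relation.Unary.All using (All; []; _∷_; lookup; tabulate; universal; universal-U)
import Data.List.Relation.Unary.All as All
open import Data.List.Relation.Unary.All.Properties using (++⁻ˡ; ++⁻ʳ) renaming (map⁺ to All-map⁺)
open import Data.List.Relation.Unary.Any using (here; there)
open import Data.Maybe using (Maybe; nothing)
open import Data.Product using (_×_; _,_; proj₁; proj₂)
open import Data.Sum using ([_,_]′)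
open import Function using (_∘_; id; _⇔_; mk⇔)
open import Relation.Binary.PropositionalEquality using (_≡_; refl; sym; trans; cong₂; subst₂)
open import Relation.Nullary using (¬_)

xs++xs⊆xs : ∀ {X : Set} (xs : List X) → xs ++ xs ⊆ xs
xs++xs⊆xs xs x∈ = [ id , id ]′ (∈-++⁻ xs x∈)

module Structural {X : Set} {Q : X → Set} {D : List X → Set}
    (weaken   : ∀ {A Θ} → Q A → D Θ → D (A ∷ Θ))
    (contract : ∀ {A Θ} → D (A ∷ A ∷ Θ) → D (A ∷ Θ))
    (exchange : ∀ {Θ Θ'} → Θ ↭ Θ' → D Θ → D Θ') where

  weaken-++ : ∀ {Θ} Θ' → All Q Θ' → D Θ → D (Θ' ++ Θ)
  weaken-++ []        []         d = d
  weaken-++ (A ∷ Θ') (qA ∷ qΘ') d = weaken qA (weaken-++ Θ' qΘ' d)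

  absorb : ∀ {A Θ} → A ∈ Θ → D (A ∷ Θ) → D Θ
  absorb {A} A∈Θ d with Θ₁ , Θ₂ , refl ← ∈-∃++ A∈Θ =
    exchange (↭-sym (shift A Θ₁ Θ₂)) (contract (exchange (prep A (shift A Θ₁ Θ₂)) d))

  absorb-++ : ∀ {Θ} Θ' → Θ' ⊆ Θ → D (Θ' ++ Θ) → D Θ
  absorb-++ []       _   d = d
  absorb-++ (A ∷ Θ') Θ'⊆Θ d = absorb-++ Θ' (Θ'⊆Θ ∘ there) (absorb (xs⊆ys++xs _ Θ' (Θ'⊆Θ (here refl))) d)

  ⊆-admissible : ∀ {Θ Θ'} → Θ ⊆ Θ' → All Q Θ' → D Θ → D Θ'
  ⊆-admissible {Θ} {Θ'} Θ⊆Θ' qΘ' d =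
    absorb-++ Θ Θ⊆Θ' (exchange (++-comm Θ' Θ) (weaken-++ Θ' qΘ' d))

module _ {V : Set} where

  LK-⊆ : ∀ {Γ Γ' Δ Δ' : List (LFm V)} → LK Γ Δ → Γ ⊆ Γ' → Δ ⊆ Δ' → LK Γ' Δ'
  LK-⊆ {Γ' = Γ'} {Δ' = Δ'} d Γ⊆Γ' Δ⊆Δ' =
    ⊆-admissible {D = LK Γ'} (λ _ → wʳ) cʳ exʳ Δ⊆Δ' (universal-U _)
      (⊆-admissible {D = λ Γ → LK Γ _} (λ _ → wˡ) cˡ exˡ Γ⊆Γ' (universal-U _) d)
    where open Structural using (⊆-admissible)

  ML-⊆ : ∀ {P : FmSet V} {Γ Γ' Δ Δ' Π} → ML P Γ Δ Π → Γ ⊆ Γ' → Δ ⊆ Δ' → All P Δ' → ML P Γ' Δ' Π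
  ML-⊆ {P} {Γ' = Γ'} {Π = Π} d Γ⊆Γ' Δ⊆Δ' pΔ' =
    ⊆-admissible {D = λ Δ → ML P Γ' Δ Π} wʳ cʳ exʳ Δ⊆Δ' pΔ'
      (⊆-admissible {D = λ Γ → ML P Γ _ Π} (λ _ → wˡ) cˡ exˡ Γ⊆Γ' (universal-U _) d)
    where open Structural using (⊆-admissible)

module Translation {V : Set} where

  τ : Fm V → LFm V
  τ 𝟘       = ⊥ᴸ
  τ ⊥'      = ⊥ᴸ
  τ (var x) = varᴸ x
  τ (A ⋀ B) = τ A ∧ᴸ τ B
  τ (A ⋁ B) = τ A ∨ᴸ τ B
  τ (A ⇒ B) = τ A →ᴸ τ B

  τ∘ι≗id : ∀ A → τ (ι A) ≡ A
  τ∘ι≗id ⊥ᴸ       = refl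
  τ∘ι≗id (varᴸ x) = refl
  τ∘ι≗id (A ∧ᴸ B) = cong₂ _∧ᴸ_ (τ∘ι≗id A) (τ∘ι≗id B)
  τ∘ι≗id (A ∨ᴸ B) = cong₂ _∨ᴸ_ (τ∘ι≗id A) (τ∘ι≗id B)
  τ∘ι≗id (A →ᴸ B) = cong₂ _→ᴸ_ (τ∘ι≗id A) (τ∘ι≗id B)

  map-τ∘map-ι : ∀ Γ → map τ (map ι Γ) ≡ Γ
  map-τ∘map-ι Γ = trans (sym (map-∘ Γ)) (map-id-local (universal τ∘ι≗id Γ))

  infix 3 _⊢ᵀ_
  _⊢ᵀ_ : List (Fm V) → List (Fm V) → Set
  Γ ⊢ᵀ Δ = LK (map τ Γ) (map τ Δ)

  ⊢ᵀ-⊆ : ∀ {Γ Γ' Δ Δ'} → Γ ⊢ᵀ Δ → Γ ⊆ Γ' → Δ ⊆ Δ' → Γ' ⊢ᵀ Δ'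
  ⊢ᵀ-⊆ d Γ⊆Γ' Δ⊆Δ' = LK-⊆ d (⊆-map⁺ τ Γ⊆Γ') (⊆-map⁺ τ Δ⊆Δ')

  ⊢ᵀ-↭ʳ : ∀ {Γ Δ Δ'} → Γ ⊢ᵀ Δ → Δ ↭ Δ' → Γ ⊢ᵀ Δ'
  ⊢ᵀ-↭ʳ d Δ↭Δ' = exʳ (↭-map⁺ τ Δ↭Δ') d

  ⊢ᵀ-++ : ∀ Γ {Γ'} Δ {Δ'} → LK (map τ Γ ++ map τ Γ') (map τ Δ ++ map τ Δ') → Γ ++ Γ' ⊢ᵀ Δ ++ Δ'
  ⊢ᵀ-++ Γ {Γ'} Δ {Δ'} = subst₂ LK (sym (map-++ τ Γ Γ')) (sym (map-++ τ Δ Δ'))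

  ⊢ᵀ-cut : ∀ {Γ Γ' Δ Δ' A} → Γ ⊢ᵀ A ∷ Δ → A ∷ Γ' ⊢ᵀ Δ' → Γ ++ Γ' ⊢ᵀ Δ ++ Δ'
  ⊢ᵀ-cut {Γ} {Δ = Δ} d e = ⊢ᵀ-++ Γ Δ (cut d e)

  ⊢ᵀ-∧ˡ : ∀ {Γ Δ A B} → A ∷ B ∷ Γ ⊢ᵀ Δ → (A ⋀ B) ∷ Γ ⊢ᵀ Δ
  ⊢ᵀ-∧ˡ d = cˡ (∧ˡ₂ (exˡ (swap _ _ ↭-refl) (∧ˡ₁ d)))

  ⊢ᵀ-∧ʳ : ∀ {Γ Γ' Δ Δ' A B} → Γ ⊢ᵀ A ∷ Δ → Γ' ⊢ᵀ B ∷ Δ' → Γ ++ Γ' ⊢ᵀ (A ⋀ B) ∷ Δ ++ Δ'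
  ⊢ᵀ-∧ʳ {Γ} {Γ'} {Δ} {Δ'} {A} {B} d e =
    ∧ʳ (⊢ᵀ-⊆ d (xs⊆xs++ys Γ Γ') (∷⁺ʳ A (xs⊆xs++ys Δ Δ')))
       (⊢ᵀ-⊆ e (xs⊆ys++xs Γ' Γ) (∷⁺ʳ B (xs⊆ys++xs Δ' Δ)))

  ⊢ᵀ-→ˡ : ∀ {Γ Γ' Δ Δ' A B} → B ∷ Γ ⊢ᵀ Δ → Γ' ⊢ᵀ A ∷ Δ' → (A ⇒ B) ∷ Γ ++ Γ' ⊢ᵀ Δ ++ Δ'
  ⊢ᵀ-→ˡ {Γ} {Γ'} {Δ} {Δ'} {A} {B} d e =
    ⊢ᵀ-⊆ (⊢ᵀ-++ ((A ⇒ B) ∷ Γ') Δ' (→ˡ e d))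
         (⊆-reflexive-↭ (prep (A ⇒ B) (++-comm Γ' Γ)))
         (⊆-reflexive-↭ (++-comm Δ' Δ))

  stoup : Maybe (Fm V) → List (Fm V) → List (Fm V)
  stoup Π Δ = fromMaybe Π ++ Δ

  ⊢ᵀ-shift : ∀ {Γ Δ A} Π → Γ ⊢ᵀ stoup Π (A ∷ Δ) → Γ ⊢ᵀ A ∷ stoup Π Δ
  ⊢ᵀ-shift {Δ = Δ} {A} Π d = ⊢ᵀ-↭ʳ d (shift A (fromMaybe Π) Δ)

  ML⇒LK : ∀ {P Γ Δ Π} → ML P Γ Δ Π → Γ ⊢ᵀ stoup Π Δ
  ML⇒LK ax = ax
  ML⇒LK (cut₁ {Δ = Δ} {Π = Π} d e) = ⊢ᵀ-↭ʳ (⊢ᵀ-cut (ML⇒LK d) (ML⇒LK e)) (shifts Δ (fromMaybe Π))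
  ML⇒LK (cut₂ {Δ = Δ} {Δ'} {Π = Π} d e) =
    ⊢ᵀ-↭ʳ (⊢ᵀ-cut (⊢ᵀ-shift Π (ML⇒LK d)) (ML⇒LK e)) (↭-++-assoc (fromMaybe Π) Δ Δ')
  ML⇒LK (der _ d) = ML⇒LK d
  ML⇒LK (cˡ d) = cˡ (ML⇒LK d)
  ML⇒LK (cʳ {Π = Π} d) = ⊢ᵀ-⊆ (ML⇒LK d) ⊆-refl (++⁺ʳ (fromMaybe Π) (∈-∷⁺ʳ (here refl) ⊆-refl))
  ML⇒LK (wˡ d) = wˡ (ML⇒LK d)
  ML⇒LK (wʳ {Δ = Δ} {A} {Π} _ d) = ⊢ᵀ-⊆ (ML⇒LK d) ⊆-refl (++⁺ʳ (fromMaybe Π) (xs⊆x∷xs Δ A))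
  ML⇒LK (exˡ Γ↭Γ' d) = exˡ (↭-map⁺ τ Γ↭Γ') (ML⇒LK d)
  ML⇒LK (exʳ {Π = Π} Δ↭Δ' d) = ⊢ᵀ-↭ʳ (ML⇒LK d) (↭-++⁺ˡ (fromMaybe Π) Δ↭Δ')
  ML⇒LK (zero _) = ⊢ᵀ-⊆ {[ 𝟘 ]} {Δ = []} bot (∈-∷⁺ʳ (here refl) (λ ())) (λ ())
  ML⇒LK bot = bot
  ML⇒LK (∧ˡ₁ _ _ d) = ⊢ᵀ-∧ˡ (ML⇒LK d)
  ML⇒LK (∧ˡ₂ d) = ⊢ᵀ-∧ˡ (ML⇒LK d)
  ML⇒LK (∧ʳ₁ d e) = ⊢ᵀ-∧ʳ (ML⇒LK d) (ML⇒LK e)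
  ML⇒LK (∧ʳ₂ d e) = ⊢ᵀ-∧ʳ (ML⇒LK d) (ML⇒LK e)
  ML⇒LK (∧ʳ₃ d e) = ⊢ᵀ-∧ʳ (ML⇒LK d) (ML⇒LK e)
  ML⇒LK (∧ʳ₄ d e) = ⊢ᵀ-∧ʳ (ML⇒LK d) (ML⇒LK e)
  ML⇒LK (∨ˡ₁ _ _ d e) = ∨ˡ (ML⇒LK d) (ML⇒LK e)
  ML⇒LK (∨ˡ₂ d e) = ∨ˡ (ML⇒LK d) (ML⇒LK e)
  ML⇒LK (∨ʳ₁ d) = ∨ʳ₁ (ML⇒LK d)
  ML⇒LK (∨ʳ₂ d) = ∨ʳ₂ (ML⇒LK d)
  ML⇒LK (∨ʳ₃ d) = ∨ʳ₁ (ML⇒LK d)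
  ML⇒LK (∨ʳ₄ d) = ∨ʳ₂ (ML⇒LK d)
  ML⇒LK (→ˡ₁ _ d e) = ⊢ᵀ-→ˡ (ML⇒LK d) (ML⇒LK e)
  ML⇒LK (→ˡ₂ d e) = ⊢ᵀ-→ˡ (ML⇒LK d) (ML⇒LK e)
  ML⇒LK (→ˡ₃ {Δ = Δ} {Π = Π} d e) =
    ⊢ᵀ-↭ʳ (⊢ᵀ-→ˡ (ML⇒LK d) (⊢ᵀ-shift Π (ML⇒LK e))) (shifts Δ (fromMaybe Π))
  ML⇒LK (→ʳ₁ d) = →ʳ (ML⇒LK d)
  ML⇒LK (→ʳ₂ d) = →ʳ (ML⇒LK d)

  ML⇒LK-ι : ∀ {P} Γ Δ → ML P (map ι Γ) (map ι Δ) nothing → LK Γ Δ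
  ML⇒LK-ι Γ Δ d = subst₂ LK (map-τ∘map-ι Γ) (map-τ∘map-ι Δ) (ML⇒LK d)

record FallibleModel (V : Set) : Set₁ where
  infix 4 _≤_
  field
    World         : Set
    _≤_           : World → World → Set
    ≤-refl        : ∀ {w} → w ≤ w
    ≤-trans       : ∀ {u v w} → u ≤ v → v ≤ w → u ≤ w
    Fallible      : World → Set
    Fallible-mono : ∀ {w w'} → w ≤ w' → Fallible w → Fallible w'
    Atom          : World → V → Set
    Atom-mono     : ∀ {w w'} x → w ≤ w' → Atom w x → Atom w' x
    Atom-stable   : ∀ w x →
      (∀ w' → w ≤ w' → (∀ w'' → w' ≤ w'' → Atom w'' x → Fallible w'') → Fallible w') → Atom w x

module Forcing {V : Set} (M : FallibleModel V) where
  open FallibleModel M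

  Refutes : (World → Set) → World → Set
  Refutes X w = ∀ w' → w ≤ w' → X w' → Fallible w'

  Refutes-mono : ∀ {X w w'} → w ≤ w' → Refutes X w → Refutes X w'
  Refutes-mono w≤w' r w'' w'≤w'' = r w'' (≤-trans w≤w' w'≤w'')

  infix 4 _⊩_ _⊩¬_
  _⊩_ : World → LFm V → Set
  w ⊩ ⊥ᴸ     = Fallible w
  w ⊩ varᴸ x = Atom w x
  w ⊩ A ∧ᴸ B = w ⊩ A × w ⊩ B
  -- Read negatively, so that forcing is stable (⊩-stable) and the semantics classical.
  w ⊩ A ∨ᴸ B = Refutes (λ v → Refutes (_⊩ A) v × Refutes (_⊩ B) v) w
  w ⊩ A →ᴸ B = ∀ w' → w ≤ w' → w' ⊩ A → w' ⊩ B

  _⊩¬_ : World → LFm V → Set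
  w ⊩¬ A = Refutes (_⊩ A) w

  ⊩-mono : ∀ A {w w'} → w ≤ w' → w ⊩ A → w' ⊩ A
  ⊩-mono ⊥ᴸ       w≤w' = Fallible-mono w≤w'
  ⊩-mono (varᴸ x) w≤w' = Atom-mono x w≤w'
  ⊩-mono (A ∧ᴸ B) w≤w' (a , b) = ⊩-mono A w≤w' a , ⊩-mono B w≤w' b
  ⊩-mono (A ∨ᴸ B) w≤w' = Refutes-mono w≤w'
  ⊩-mono (A →ᴸ B) w≤w' f w'' w'≤w'' = f w'' (≤-trans w≤w' w'≤w'')

  ⊩-stable : ∀ A {w} → Refutes (_⊩¬ A) w → w ⊩ A
  ⊩-stable ⊥ᴸ       r = r _ ≤-refl (λ _ _ f → f)
  ⊩-stable (varᴸ x) r = Atom-stable _ x r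
  ⊩-stable (A ∧ᴸ B) r =
    ⊩-stable A (λ w' w≤w' ¬a → r w' w≤w' (λ w'' w'≤w'' (a , _) → ¬a w'' w'≤w'' a)) ,
    ⊩-stable B (λ w' w≤w' ¬b → r w' w≤w' (λ w'' w'≤w'' (_ , b) → ¬b w'' w'≤w'' b))
  ⊩-stable (A ∨ᴸ B) r w' w≤w' (¬a , ¬b) =
    r w' w≤w' (λ w'' w'≤w'' a∨b → a∨b w'' ≤-refl (Refutes-mono w'≤w'' ¬a , Refutes-mono w'≤w'' ¬b))
  ⊩-stable (A →ᴸ B) r w' w≤w' a = ⊩-stable B λ w'' w'≤w'' ¬b →
    r w'' (≤-trans w≤w' w'≤w'') λ w''' w''≤w''' a→b →
      ¬b w''' w''≤w''' (a→b w''' ≤-refl (⊩-mono A (≤-trans w'≤w'' w''≤w''') a))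

  ⊩*-mono : ∀ {Γ w w'} → w ≤ w' → All (w ⊩_) Γ → All (w' ⊩_) Γ
  ⊩*-mono w≤w' = All.map (λ {A} → ⊩-mono A w≤w')

  ⊩¬*-mono : ∀ {Δ w w'} → w ≤ w' → All (w ⊩¬_) Δ → All (w' ⊩¬_) Δ
  ⊩¬*-mono w≤w' = All.map (Refutes-mono w≤w')

  LK-sound : ∀ {Γ Δ} → LK Γ Δ → ∀ w → All (w ⊩_) Γ → All (w ⊩¬_) Δ → Fallible w
  LK-sound ax w (a ∷ []) (¬a ∷ []) = ¬a w ≤-refl a
  LK-sound bot w (f ∷ []) [] = f
  LK-sound (cut {Γ} {Δ = Δ} {A = A} d e) w ts fs =
    LK-sound d w (++⁻ˡ Γ ts) (¬a ∷ ++⁻ˡ Δ fs)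
    where
    ¬a : w ⊩¬ A
    ¬a w' w≤w' a = LK-sound e w' (a ∷ ⊩*-mono w≤w' (++⁻ʳ Γ ts)) (⊩¬*-mono w≤w' (++⁻ʳ Δ fs))
  LK-sound (wˡ d) w (_ ∷ ts) fs = LK-sound d w ts fs
  LK-sound (wʳ d) w ts (_ ∷ fs) = LK-sound d w ts fs
  LK-sound (cˡ d) w (t ∷ ts) fs = LK-sound d w (t ∷ t ∷ ts) fs
  LK-sound (cʳ d) w ts (f ∷ fs) = LK-sound d w ts (f ∷ f ∷ fs)
  LK-sound (exˡ Γ↭Γ' d) w ts fs = LK-sound d w (All-resp-↭ (↭-sym Γ↭Γ') ts) fs
  LK-sound (exʳ Δ↭Δ' d) w ts fs = LK-sound d w ts (All-resp-↭ (↭-sym Δ↭Δ') fs)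
  LK-sound (∧ˡ₁ d) w ((a , _) ∷ ts) fs = LK-sound d w (a ∷ ts) fs
  LK-sound (∧ˡ₂ d) w ((_ , b) ∷ ts) fs = LK-sound d w (b ∷ ts) fs
  LK-sound (∧ʳ {A = A} {B} d e) w ts (¬a∧b ∷ fs) =
    LK-sound d w ts (¬a ∷ fs)
    where
    ¬a : w ⊩¬ A
    ¬a w' w≤w' a = LK-sound e w' (⊩*-mono w≤w' ts) (¬b ∷ ⊩¬*-mono w≤w' fs)
      where
      ¬b : w' ⊩¬ B
      ¬b w'' w'≤w'' b = ¬a∧b w'' (≤-trans w≤w' w'≤w'') (⊩-mono A w'≤w'' a , b)
  LK-sound (∨ˡ {A = A} {B} d e) w (a∨b ∷ ts) fs = a∨b w ≤-refl (¬a , ¬b)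
    where
    ¬a : w ⊩¬ A
    ¬a w' w≤w' a = LK-sound d w' (a ∷ ⊩*-mono w≤w' ts) (⊩¬*-mono w≤w' fs)
    ¬b : w ⊩¬ B
    ¬b w' w≤w' b = LK-sound e w' (b ∷ ⊩*-mono w≤w' ts) (⊩¬*-mono w≤w' fs)
  LK-sound (∨ʳ₁ {A = A} d) w ts (¬a∨b ∷ fs) =
    LK-sound d w ts ((λ w' w≤w' a → ¬a∨b w' w≤w' λ w'' w'≤w'' (¬a , _) → ¬a w'' ≤-refl (⊩-mono A w'≤w'' a)) ∷ fs)
  LK-sound (∨ʳ₂ {B = B} d) w ts (¬a∨b ∷ fs) =
    LK-sound d w ts ((λ w' w≤w' b → ¬a∨b w' w≤w' λ w'' w'≤w'' (_ , ¬b) → ¬b w'' ≤-refl (⊩-mono B w'≤w'' b)) ∷ fs)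
  LK-sound (→ˡ {Γ} {Δ = Δ} {A = A} d e) w (a→b ∷ ts) fs =
    LK-sound d w (++⁻ˡ Γ ts) (¬a ∷ ++⁻ˡ Δ fs)
    where
    ¬a : w ⊩¬ A
    ¬a w' w≤w' a = LK-sound e w' (a→b w' w≤w' a ∷ ⊩*-mono w≤w' (++⁻ʳ Γ ts)) (⊩¬*-mono w≤w' (++⁻ʳ Δ fs))
  LK-sound (→ʳ {A = A} {B} d) w ts (¬a→b ∷ fs) = ¬a→b w ≤-refl a→b
    where
    a→b : w ⊩ A →ᴸ B
    a→b w' w≤w' a = ⊩-stable B λ w'' w'≤w'' ¬b →
      let w≤w'' = ≤-trans w≤w' w'≤w'' in
      LK-sound d w'' (⊩-mono A w'≤w'' a ∷ ⊩*-mono w≤w'' ts) (¬b ∷ ⊩¬*-mono w≤w'' fs)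

module Universal {V : Set} (P K : FmSet V) (K-stable : Stable K) (K⊆P : ∀ {A} → K A → P A) where

  Sequent : Set
  Sequent = List (LFm V) × List (LFm V)

  infix 4 _≼_
  _≼_ : Sequent → Sequent → Set
  s ≼ s' = proj₁ s ⊆ proj₁ s' × proj₂ s ⊆ proj₂ s'

  ≼-trans : ∀ {s s' s''} → s ≼ s' → s' ≼ s'' → s ≼ s''
  ≼-trans (Γ⊆ , Δ⊆) (Γ'⊆ , Δ'⊆) = ⊆-trans Γ⊆ Γ'⊆ , ⊆-trans Δ⊆ Δ'⊆

  InK : List (LFm V) → Set
  InK = All (K ∘ ι)

  Provable : Sequent → Set
  Provable (Γ , Δ) = InK Γ → InK Δ → ML P (map ι Γ) (map ι Δ) nothing

  Closed : Sequent → Set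
  Closed s = ∀ s' → s ≼ s' → Provable s'

  Closed-mono : ∀ {s s'} → s ≼ s' → Closed s → Closed s'
  Closed-mono s≼s' c s'' s'≼s'' = c s'' (≼-trans s≼s' s'≼s'')

  Closed-absorb : ∀ {Γ Δ A} → A ∈ Δ → Closed (Γ , A ∷ Δ) → Closed (Γ , Δ)
  Closed-absorb A∈Δ = Closed-mono (⊆-refl , ∈-∷⁺ʳ A∈Δ ⊆-refl)

  model : FallibleModel V
  model = record
    { World         = Sequent
    ; _≤_           = _≼_
    ; ≤-refl        = ⊆-refl , ⊆-refl
    ; ≤-trans       = ≼-trans
    ; Fallible      = Closed
    ; Fallible-mono = Closed-mono
    ; Atom          = λ (Γ , Δ) x → Closed (Γ , varᴸ x ∷ Δ)
    ; Atom-mono     = λ x (Γ⊆ , Δ⊆) → Closed-mono (Γ⊆ , ∷⁺ʳ (varᴸ x) Δ⊆)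
    ; Atom-stable   = λ (Γ , Δ) x r → r (Γ , varᴸ x ∷ Δ) (⊆-refl , xs⊆x∷xs Δ (varᴸ x))
        λ _ (_ , x∷Δ⊆) → Closed-absorb (x∷Δ⊆ (here refl))
    }

  open Forcing model

  K-∧ : ∀ {A B} → K (ι (A ∧ᴸ B)) → K (ι A) × K (ι B)
  K-∧ = proj₁ K-stable _ _

  K-∨ : ∀ {A B} → K (ι (A ∨ᴸ B)) → K (ι A) × K (ι B)
  K-∨ = proj₁ (proj₂ K-stable) _ _

  K-→ : ∀ {A B} → K (ι (A →ᴸ B)) → K (ι A) × K (ι B)
  K-→ = proj₂ (proj₂ K-stable) _ _

  InK⇒P : ∀ {Δ} → InK Δ → All P (map ι Δ)
  InK⇒P kΔ = All-map⁺ (All.map K⊆P kΔ)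

  closed-ax : ∀ {Γ Δ A} → A ∈ Γ → A ∈ Δ → Closed (Γ , Δ)
  closed-ax A∈Γ A∈Δ _ (Γ⊆ , Δ⊆) kΓ kΔ =
    ML-⊆ (der (K⊆P (lookup kΔ (Δ⊆ A∈Δ))) ax)
         (∈-∷⁺ʳ (∈-map⁺ ι (Γ⊆ A∈Γ)) (λ ())) (∈-∷⁺ʳ (∈-map⁺ ι (Δ⊆ A∈Δ)) (λ ())) (InK⇒P kΔ)

  closed-⊥ : ∀ {Γ Δ} → ⊥ᴸ ∈ Γ → Closed (Γ , Δ)
  closed-⊥ ⊥∈Γ _ (Γ⊆ , _) _ kΔ =
    ML-⊆ bot (∈-∷⁺ʳ (∈-map⁺ ι (Γ⊆ ⊥∈Γ)) (λ ())) (λ ()) (InK⇒P kΔ)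

  closed-∧ʳ : ∀ {Γ Δ A B} → (A ∧ᴸ B) ∈ Δ → Closed (Γ , A ∷ Δ) → Closed (Γ , B ∷ Δ) → Closed (Γ , Δ)
  closed-∧ʳ {A = A} {B} m cA cB _ (Γ⊆ , Δ⊆) kΓ kΔ =
    ML-⊆ (der (K⊆P kA∧B) (∧ʳ₂ (cA _ (Γ⊆ , ∷⁺ʳ A Δ⊆) kΓ (proj₁ (K-∧ kA∧B) ∷ kΔ))
                               (cB _ (Γ⊆ , ∷⁺ʳ B Δ⊆) kΓ (proj₂ (K-∧ kA∧B) ∷ kΔ))))
         (xs++xs⊆xs _) (∈-∷⁺ʳ (∈-map⁺ ι (Δ⊆ m)) (xs++xs⊆xs _)) (InK⇒P kΔ)
    where kA∧B = lookup kΔ (Δ⊆ m)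

  closed-∨ʳ₁ : ∀ {Γ Δ A B} → (A ∨ᴸ B) ∈ Δ → Closed (Γ , A ∷ Δ) → Closed (Γ , Δ)
  closed-∨ʳ₁ {A = A} m cA _ (Γ⊆ , Δ⊆) kΓ kΔ =
    ML-⊆ (der (K⊆P kA∨B) (∨ʳ₃ (cA _ (Γ⊆ , ∷⁺ʳ A Δ⊆) kΓ (proj₁ (K-∨ kA∨B) ∷ kΔ))))
         ⊆-refl (∈-∷⁺ʳ (∈-map⁺ ι (Δ⊆ m)) ⊆-refl) (InK⇒P kΔ)
    where kA∨B = lookup kΔ (Δ⊆ m)

  closed-∨ʳ₂ : ∀ {Γ Δ A B} → (A ∨ᴸ B) ∈ Δ → Closed (Γ , B ∷ Δ) → Closed (Γ , Δ)
  closed-∨ʳ₂ {B = B} m cB _ (Γ⊆ , Δ⊆) kΓ kΔ =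
    ML-⊆ (der (K⊆P kA∨B) (∨ʳ₄ (cB _ (Γ⊆ , ∷⁺ʳ B Δ⊆) kΓ (proj₂ (K-∨ kA∨B) ∷ kΔ))))
         ⊆-refl (∈-∷⁺ʳ (∈-map⁺ ι (Δ⊆ m)) ⊆-refl) (InK⇒P kΔ)
    where kA∨B = lookup kΔ (Δ⊆ m)

  closed-→ʳ : ∀ {Γ Δ A B} → (A →ᴸ B) ∈ Δ → Closed (A ∷ Γ , B ∷ Δ) → Closed (Γ , Δ)
  closed-→ʳ {A = A} {B} m c _ (Γ⊆ , Δ⊆) kΓ kΔ =
    ML-⊆ (der (K⊆P kA→B) (→ʳ₂ (c _ (∷⁺ʳ A Γ⊆ , ∷⁺ʳ B Δ⊆) (proj₁ (K-→ kA→B) ∷ kΓ) (proj₂ (K-→ kA→B) ∷ kΔ))))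
         ⊆-refl (∈-∷⁺ʳ (∈-map⁺ ι (Δ⊆ m)) ⊆-refl) (InK⇒P kΔ)
    where kA→B = lookup kΔ (Δ⊆ m)

  closed-∧ˡ : ∀ {Γ Δ A B} → (A ∧ᴸ B) ∈ Γ → Closed (A ∷ B ∷ Γ , Δ) → Closed (Γ , Δ)
  closed-∧ˡ {A = A} {B} m c _ (Γ⊆ , Δ⊆) kΓ kΔ =
    ML-⊆ (∧ˡ₂ (c _ (∷⁺ʳ A (∷⁺ʳ B Γ⊆) , Δ⊆) (proj₁ (K-∧ kA∧B) ∷ proj₂ (K-∧ kA∧B) ∷ kΓ) kΔ))
         (∈-∷⁺ʳ (∈-map⁺ ι (Γ⊆ m)) ⊆-refl) ⊆-refl (InK⇒P kΔ)
    where kA∧B = lookup kΓ (Γ⊆ m)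

  closed-∨ˡ : ∀ {Γ Δ A B} → (A ∨ᴸ B) ∈ Γ → Closed (A ∷ Γ , Δ) → Closed (B ∷ Γ , Δ) → Closed (Γ , Δ)
  closed-∨ˡ {A = A} {B} m cA cB _ (Γ⊆ , Δ⊆) kΓ kΔ =
    ML-⊆ (∨ˡ₂ (cA _ (∷⁺ʳ A Γ⊆ , Δ⊆) (proj₁ (K-∨ kA∨B) ∷ kΓ) kΔ)
              (cB _ (∷⁺ʳ B Γ⊆ , Δ⊆) (proj₂ (K-∨ kA∨B) ∷ kΓ) kΔ))
         (∈-∷⁺ʳ (∈-map⁺ ι (Γ⊆ m)) ⊆-refl) ⊆-refl (InK⇒P kΔ)
    where kA∨B = lookup kΓ (Γ⊆ m)

  closed-→ˡ : ∀ {Γ Δ A B} → (A →ᴸ B) ∈ Γ → Closed (B ∷ Γ , Δ) → Closed (Γ , A ∷ Δ) → Closed (Γ , Δ)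
  closed-→ˡ {A = A} {B} m cB cA _ (Γ⊆ , Δ⊆) kΓ kΔ =
    ML-⊆ (→ˡ₃ (cB _ (∷⁺ʳ B Γ⊆ , Δ⊆) (proj₂ (K-→ kA→B) ∷ kΓ) kΔ)
              (cA _ (Γ⊆ , ∷⁺ʳ A Δ⊆) kΓ (proj₁ (K-→ kA→B) ∷ kΔ)))
         (∈-∷⁺ʳ (∈-map⁺ ι (Γ⊆ m)) (xs++xs⊆xs _)) (xs++xs⊆xs _) (InK⇒P kΔ)
    where kA→B = lookup kΓ (Γ⊆ m)

  reify   : ∀ A {Γ Δ} → (Γ , Δ) ⊩ A → Closed (Γ , A ∷ Δ)
  reflect : ∀ A {Γ Δ} → A ∈ Γ → (Γ , Δ) ⊩ A

  reify ⊥ᴸ       {Δ = Δ} c = Closed-mono (⊆-refl , xs⊆x∷xs Δ ⊥ᴸ) c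
  reify (varᴸ x) c = c
  reify (A ∧ᴸ B) {Δ = Δ} (a , b) =
    closed-∧ʳ (here refl) (Closed-mono (⊆-refl , ∷⁺ʳ A (xs⊆x∷xs Δ _)) (reify A a))
                          (Closed-mono (⊆-refl , ∷⁺ʳ B (xs⊆x∷xs Δ _)) (reify B b))
  reify (A ∨ᴸ B) {Γ} {Δ} a∨b = a∨b (Γ , (A ∨ᴸ B) ∷ Δ) (⊆-refl , xs⊆x∷xs Δ _) (¬a , ¬b)
    where
    ¬a : (Γ , (A ∨ᴸ B) ∷ Δ) ⊩¬ A
    ¬a _ (_ , Δ⊆) a = closed-∨ʳ₁ (Δ⊆ (here refl)) (reify A a)
    ¬b : (Γ , (A ∨ᴸ B) ∷ Δ) ⊩¬ B
    ¬b _ (_ , Δ⊆) b = closed-∨ʳ₂ (Δ⊆ (here refl)) (reify B b)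
  reify (A →ᴸ B) {Γ} {Δ} a→b =
    closed-→ʳ (here refl) (Closed-mono (⊆-refl , ∷⁺ʳ B (xs⊆x∷xs Δ _))
      (reify B (a→b (A ∷ Γ , Δ) (xs⊆x∷xs Γ A , ⊆-refl) (reflect A (here refl)))))

  reflect ⊥ᴸ       ⊥∈Γ = closed-⊥ ⊥∈Γ
  reflect (varᴸ x) x∈Γ = closed-ax x∈Γ (here refl)
  -- A ∧ B ∈ Γ does not make A a hypothesis; by stability it suffices to close the
  -- extensions refuting A, where ∧ˡ may add A and B to the hypotheses.
  reflect (A ∧ᴸ B) m = ⊩-stable A ¬¬a , ⊩-stable B ¬¬b
    where
    ¬¬a : Refutes (_⊩¬ A) _
    ¬¬a (Γ' , Δ') (Γ⊆ , _) ¬a =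
      closed-∧ˡ (Γ⊆ m) (¬a (A ∷ B ∷ Γ' , Δ') (xs⊆x∷xs _ A ∘ xs⊆x∷xs Γ' B , ⊆-refl) (reflect A (here refl)))
    ¬¬b : Refutes (_⊩¬ B) _
    ¬¬b (Γ' , Δ') (Γ⊆ , _) ¬b =
      closed-∧ˡ (Γ⊆ m) (¬b (A ∷ B ∷ Γ' , Δ') (xs⊆x∷xs _ A ∘ xs⊆x∷xs Γ' B , ⊆-refl) (reflect B (there (here refl))))
  reflect (A ∨ᴸ B) m (Γ' , Δ') (Γ⊆ , _) (¬a , ¬b) =
    closed-∨ˡ (Γ⊆ m) (¬a (A ∷ Γ' , Δ') (xs⊆x∷xs Γ' A , ⊆-refl) (reflect A (here refl)))
                     (¬b (B ∷ Γ' , Δ') (xs⊆x∷xs Γ' B , ⊆-refl) (reflect B (here refl)))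
  reflect (A →ᴸ B) m s' s≼s' a = ⊩-stable B ¬¬b
    where
    ¬¬b : Refutes (_⊩¬ B) s'
    ¬¬b (Γ'' , Δ'') s'≼s'' ¬b =
      closed-→ˡ (proj₁ (≼-trans s≼s' s'≼s'') m)
        (¬b (B ∷ Γ'' , Δ'') (xs⊆x∷xs Γ'' B , ⊆-refl) (reflect B (here refl)))
        (reify A (⊩-mono A s'≼s'' a))

  refute-conclusion : ∀ {Γ Δ A} → A ∈ Δ → (Γ , Δ) ⊩¬ A
  refute-conclusion {A = A} A∈Δ _ (_ , Δ⊆) a = Closed-absorb (Δ⊆ A∈Δ) (reify A a)

  LK⇒ML : ∀ {Γ Δ} → LK Γ Δ → InK Γ → InK Δ → ML P (map ι Γ) (map ι Δ) nothing
  LK⇒ML {Γ} {Δ} d = LK-sound d (Γ , Δ) (tabulate (reflect _)) (tabulate refute-conclusion) (Γ , Δ) (⊆-refl , ⊆-refl)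

theorem4p2 : {V : Set} (P K : FmSet V) → Stable K → (∀ {A} → K A → P A) → ¬ K 𝟘
    → (Γ Δ : List (LFm V)) → All (K ∘ ι) Γ → All (K ∘ ι) Δ
    → ML P (map ι Γ) (map ι Δ) nothing ⇔ LK Γ Δ
theorem4p2 P K K-stable K⊆P _ Γ Δ kΓ kΔ =
  mk⇔ (Translation.ML⇒LK-ι Γ Δ) (λ d → Universal.LK⇒ML P K K-stable K⊆P d kΓ kΔ)
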